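{- For any marked Petri nets $N,N_1,N_2$: (1) $(N,\emptyset,N)$ is a net-abstraction; (2) if $(N_1,Q,N_2)$ is a net-abstraction, then $(N_1,Q',N_3)$ is a net-abstraction in each of the following cases: (T) $Q'=Q$ and $N_3$ is obtained from $N_2$ by removing a redundant transition; (R) $Q'=(Q;\,k\cdot p=l)$, where $N_3$ is obtained from $N_2$ by removing a redundant place $p$ with witnesses $I,v,b$, and $k\cdot p=l$ is its associated marking equation, namely $k=v(p)$ and $l=\sum_{q\in I}v(q)\cdot q+b$; (A) $Q'=(Q;\,a=\sum_{p\in A}p)$, where $a\notin\mathrm{V}(Q)$ and $N_3$ is obtained from $N_2$ by agglomerating (by chain or loop agglomeration) the places of a set $A$ as a new place $a$; (L) $Q'=(Q;\,p\le k)$, where $N_3$ is obtained from $N_2$ by removing a source-sink pair $(p,t)$ with $m_0(p)=k$ ($m_0$ the initial marking of $N_2$).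
   Context: A marked Petri net is a tuple $N=(P,T,\mathrm{Pre},\mathrm{Post},m_0)$ with $P,T$ disjoint finite sets, $\mathrm{Pre},\mathrm{Post}:T\to(P\to\mathbb{N})$, $m_0:P\to\mathbb{N}$. Markings are maps $P\to\mathbb{N}$ (pointwise order/arithmetic); $t$ is enabled at $m$ if $m\ge\mathrm{Pre}(t)$, and firing gives $m-\mathrm{Pre}(t)+\mathrm{Post}(t)$; $\mathcal{R}(N)\subseteq\mathbb{N}^P$ is the set of markings reachable from $m_0$. Pre/post sets: ${}^\bullet t=\{p\mid\mathrm{Pre}(t)(p)>0\}$, $t^\bullet=\{p\mid\mathrm{Post}(t)(p)>0\}$, ${}^\bullet p=\{t\mid\mathrm{Post}(t)(p)>0\}$, $p^\bullet=\{t\mid\mathrm{Pre}(t)(p)>0\}$. Redundant transition: $t$ such that some firing sequence $\sigma$ over $T\setminus\{t\}$ has displacement $\Delta(\sigma)=\Delta(t)$ and hurdle $H(t)\ge H(\sigma)$, where $\Delta(t_1\cdots t_n)=\sum_i(\mathrm{Post}(t_i)-\mathrm{Pre}(t_i))$ and the hurdle is the smallest marking from which the sequence is firable; removing it deletes $t$. Redundant place: $p$ such that there are $I\subseteq P\setminus\{p\}$, $v:I\cup\{p\}\to\mathbb{N}\setminus\{0\}$, $b\in\mathbb{N}$ with $b=v(p)m_0(p)-\sum_{q\in I}v(q)m_0(q)$ and, for all $t\in T$, $v(p)\mathrm{Pre}(t)(p)-\sum_{q\in I}v(q)\mathrm{Pre}(t)(q)\le b$ and $v(p)(\mathrm{Post}(t)(p)-\mathrm{Pre}(t)(p))=\sum_{q\in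 I}v(q)(\mathrm{Post}(t)(q)-\mathrm{Pre}(t)(q))$; removing it deletes $p$. Sum of places: $a=\boxplus_{r\in A}r$ means $m_0(a)=\sum_{r\in A}m_0(r)$ and $\mathrm{Pre}(t)(a)=\sum_{r\in A}\mathrm{Pre}(t)(r)$, $\mathrm{Post}(t)(a)=\sum_{r\in A}\mathrm{Post}(t)(r)$ for all $t$; agglomerating $A$ as $a$ replaces the places of $A$ by $a$. $A=\{p,q\}$ is chain agglomerable if some $t$ has ${}^\bullet t=\{p\}$, $t^\bullet=\{q\}$, $\mathrm{Pre}(t)(p)=\mathrm{Post}(t)(q)=1$, ${}^\bullet q=\{t\}$, $m_0(q)=0$. $A=\{\pi_0,\dots,\pi_{n-1}\}$ is loop agglomerable if for each $i<n$ some $t$ has $\mathrm{Pre}(t)$ equal to $1$ on $\pi_i$ and $0$ elsewhere and $\mathrm{Post}(t)$ equal to $1$ on $\pi_{(i+1)\bmod n}$ and $0$ elsewhere. Source-sink pair $(p,t)$: ${}^\bullet p=\emptyset$, $p^\bullet=\{t\}$, $\mathrm{Pre}(t)$ is $1$ on $p$ and $0$ elsewhere, $\mathrm{Post}(t)=0$; removing it deletes $p$ and $t$. Linear systems: $Q$ denotes a finite system of linear equations and inequalities over non-negative integer variables; place names are used as variables. $\mathrm{V}(Q)$ is its set of variables, $(Q_1;Q_2)$ the concatenation of systems, $\emptyset$ the empty system. $[\![Q]\!]\subseteq\mathbb{N}^{\mathrm{V}(Q)}$ is the set of solutions of $Q$. For $E\subseteq\mathbb{N}^{\mathcal{V}}$: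 $E\downarrow\mathcal{U}$ is the projection (restriction of each element to $\mathcal{U}$), and $E\uparrow\mathcal{U}$ (for $\mathcal{U}\supseteq\mathcal{V}$) is the largest $E'\subseteq\mathbb{N}^{\mathcal{U}}$ with $E'\downarrow\mathcal{V}=E$. A triple $(N_1,Q,N_2)$, with $N_1,N_2$ nets with place sets $P_1,P_2$ (possibly overlapping), is a net-abstraction if $\mathcal{R}(N_1)=\big((\mathcal{R}(N_2)\uparrow\mathcal{V})\cap([\![Q]\!]\uparrow\mathcal{V})\big)\downarrow P_1$ where $\mathcal{V}=\mathrm{V}(Q)\cup P_1\cup P_2$. -}

module Defs where

open import Data.Nat using (ℕ; zero; suc; _+_; _*_; _∸_; _≤_; _<_; _≟_)
open import Data.Integer as ℤ using (ℤ; +_; 0ℤ)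
open import Data.List using (List; []; _∷_; _++_; map; filter; foldr; concatMap)
open import Data.Nat.ListAction using (sum)
open import Data.List.Membership.Propositional using (_∈_; _∉_)
open import Data.List.Membership.DecPropositional _≟_ using (_∈?_)
open import Data.List.Relation.Unary.All using (All)
open import Data.List.Relation.Unary.Unique.Propositional using (Unique)
open import Data.Product using (Σ; ∃; ∃-syntax; _×_; _,_)
open import Data.Sum using (_⊎_)
open import Data.Unit using (⊤)
open import Data.Bool using (if_then_else_)
open import Relation.Nullary using (¬_)
open import Relation.Nullary.Decidable using (¬?; ⌊_⌋)
open import Relation.Binary.PropositionalEquality using (_≡_; _≢_)
open import Function.Bundles using (_⇔_)

-- Names.  Places and transitions are named by natural numbers (so that
-- the place sets of different nets may overlap and places can serve as
-- variables of linear systems).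

Name : Set
Name = ℕ

-- Markings are functions Name → ℕ; only their values on the places of
-- the net matter (a marking in ℕ^P is represented by any function that
-- agrees with it on P).

record Net : Set where
  field
    places : List Name
    trans  : List Name
    pre    : Name → Name → ℕ      -- pre t p  = Pre(t)(p)
    post   : Name → Name → ℕ      -- post t p = Post(t)(p)
    m0     : Name → ℕ
open Net public

Marking : Set
Marking = Name → ℕ

Enabled : Net → Name → Marking → Set
Enabled N t m = ∀ p → p ∈ places N → pre N t p ≤ m p

fire : Net → Name → Marking → Marking
fire N t m p = (m p ∸ pre N t p) + post N t p

data Reach (N : Net) : Marking → Set where
  init : ∀ {m} → (∀ p → p ∈ places N → m p ≡ m0 N p) → Reach N m
  step : ∀ {m m'} t → t ∈ trans N → Reach N m → Enabled N t m →
         (∀ p → p ∈ places N → m' p ≡ fire N t m p) → Reach N m'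

Firable : Net → List Name → Marking → Set
Firable N []      m = ⊤
Firable N (t ∷ σ) m = Enabled N t m × Firable N σ (fire N t m)

IsHurdle : Net → List Name → Marking → Set
IsHurdle N σ h =
  Firable N σ h × (∀ m → Firable N σ m → ∀ p → p ∈ places N → h p ≤ m p)

Δt : Net → Name → Name → ℤ
Δt N t p = (+ post N t p) ℤ.- (+ pre N t p)

Δ : Net → List Name → Name → ℤ
Δ N σ p = foldr (λ t z → Δt N t p ℤ.+ z) 0ℤ σ

RedundantTransition : Net → Name → Set
RedundantTransition N t =
  t ∈ trans N ×
  ∃[ σ ] ( All (λ u → u ∈ trans N × u ≢ t) σ
         × (∀ p → p ∈ places N → Δ N σ p ≡ Δt N t p)
         × ∃[ hσ ] ∃[ ht ] ( IsHurdle N σ hσ × IsHurdle N (t ∷ []) ht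
                           × (∀ p → p ∈ places N → hσ p ≤ ht p)))

removeTransition : Net → Name → Net
removeTransition N t = record N { trans = filter (λ u → ¬? (u ≟ t)) (trans N) }

sumOver : List Name → (Name → ℕ) → ℕ
sumOver I f = sum (map f I)

sumOverℤ : List Name → (Name → ℤ) → ℤ
sumOverℤ I f = foldr (λ q z → f q ℤ.+ z) 0ℤ I

RedundantPlace : Net → Name → List Name → (Name → ℕ) → ℕ → Set
RedundantPlace N p I v b =
  p ∈ places N × Unique I ×
  All (λ q → q ∈ places N × q ≢ p) I ×
  (0 < v p) × All (λ q → 0 < v q) I ×
  ((+ b) ≡ (+ (v p * m0 N p)) ℤ.- (+ sumOver I (λ q → v q * m0 N q))) ×
  (∀ t → t ∈ trans N →
     ((+ (v p * pre N t p)) ℤ.- (+ sumOver I (λ q → v q * pre N t q)) ℤ.≤ (+ b))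
     × ((+ v p) ℤ.* Δt N t p ≡ sumOverℤ I (λ q → (+ v q) ℤ.* Δt N t q)))

removePlace : Net → Name → Net
removePlace N p = record N { places = filter (λ q → ¬? (q ≟ p)) (places N) }

agglomerate : Net → List Name → Name → Net
agglomerate N A a = record
  { places = a ∷ filter (λ r → ¬? (r ∈? A)) (places N)
  ; trans  = trans N
  ; pre    = λ t r → if ⌊ r ≟ a ⌋ then sumOver A (pre N t) else pre N t r
  ; post   = λ t r → if ⌊ r ≟ a ⌋ then sumOver A (post N t) else post N t r
  ; m0     = λ r → if ⌊ r ≟ a ⌋ then sumOver A (m0 N) else m0 N r
  }

ChainAgglomerable : Net → List Name → Set
ChainAgglomerable N A =
  Unique A × All (λ r → r ∈ places N) A ×
  ∃[ p ] ∃[ q ] ( (∀ r → (r ∈ A) ⇔ (r ≡ p ⊎ r ≡ q))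
    × ∃[ t ] ( t ∈ trans N
             × (∀ r → r ∈ places N → (0 < pre N t r) ⇔ (r ≡ p))
             × (∀ r → r ∈ places N → (0 < post N t r) ⇔ (r ≡ q))
             × pre N t p ≡ 1 × post N t q ≡ 1
             × (∀ u → u ∈ trans N → (0 < post N u q) ⇔ (u ≡ t))
             × m0 N q ≡ 0))

cycPairs : List Name → List (Name × Name)
cycPairs []       = []
cycPairs (x ∷ xs) = go (x ∷ xs)
  where
  go : List Name → List (Name × Name)
  go []            = []
  go (y ∷ [])      = (y , x) ∷ []
  go (y ∷ z ∷ r)   = (y , z) ∷ go (z ∷ r)

-- A = {π_0, …, π_{n-1}} (listed in this order) is loop agglomerable
LoopAgglomerable : Net → List Name → Set
LoopAgglomerable N A =
  Unique A × All (λ r → r ∈ places N) A ×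
  All (λ { (πi , πj) → ∃[ t ] ( t ∈ trans N
          × pre N t πi ≡ 1 × (∀ r → r ∈ places N → r ≢ πi → pre N t r ≡ 0)
          × post N t πj ≡ 1 × (∀ r → r ∈ places N → r ≢ πj → post N t r ≡ 0)) })
      (cycPairs A)

SourceSink : Net → Name → Name → Set
SourceSink N p t =
  p ∈ places N × t ∈ trans N ×
  (∀ u → u ∈ trans N → post N u p ≡ 0) ×
  (∀ u → u ∈ trans N → (0 < pre N u p) ⇔ (u ≡ t)) ×
  pre N t p ≡ 1 × (∀ r → r ∈ places N → r ≢ p → pre N t r ≡ 0) ×
  (∀ r → r ∈ places N → post N t r ≡ 0)

removeSourceSink : Net → Name → Name → Net
removeSourceSink N p t = removePlace (removeTransition N t) p

-- Linear systems over ℕ-valued variables (names).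
-- A constraint is  Σ c·x + c₀  (= or ≤)  Σ d·y + d₀  with ℕ coefficients.

data Rel : Set where
  eq le : Rel

record Constraint : Set where
  constructor constr
  field
    lhs  : List (ℕ × Name)
    lcst : ℕ
    rel  : Rel
    rhs  : List (ℕ × Name)
    rcst : ℕ
open Constraint public

System : Set
System = List Constraint

lin : List (ℕ × Name) → (Name → ℕ) → ℕ
lin ts x = sum (map (λ { (c , v) → c * x v }) ts)

holdsRel : Rel → ℕ → ℕ → Set
holdsRel eq m n = m ≡ n
holdsRel le m n = m ≤ n

Holds : Constraint → (Name → ℕ) → Set
Holds c x = holdsRel (rel c) (lin (lhs c) x + lcst c) (lin (rhs c) x + rcst c)

Sat : System → (Name → ℕ) → Set
Sat Q x = All (λ c → Holds c x) Q

vars : System → List Name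
vars Q = concatMap (λ c → map (λ { (_ , v) → v }) (lhs c ++ rhs c)) Q

_⨾_ : System → Constraint → System
Q ⨾ c = Q ++ (c ∷ [])

markingEq : Name → List Name → (Name → ℕ) → ℕ → Constraint
markingEq p I v b = constr ((v p , p) ∷ []) 0 eq (map (λ q → (v q , q)) I) b

sumEq : Name → List Name → Constraint
sumEq a A = constr ((1 , a) ∷ []) 0 eq (map (λ p → (1 , p)) A) 0

leEq : Name → ℕ → Constraint
leEq p k = constr ((1 , p) ∷ []) 0 le [] k

-- Net abstraction:
--  R(N1) = ((R(N2)↑V) ∩ ([[Q]]↑V))↓P1,   V = V(Q) ∪ P1 ∪ P2.
-- An element of ℕ^V is represented by a total valuation x : Name → ℕ.

NetAbstraction : Net → System → Net → Set
NetAbstraction N1 Q N2 =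
  ∀ (m : Marking) →
    Reach N1 m ⇔ (∃[ x ] (Reach N2 x × Sat Q x × (∀ p → p ∈ places N1 → x p ≡ m p)))

-- Each rule is proved by simulating runs of one net by runs of the other.
-- A firing of a redundant transition t is replayed by its replacement sequence σ: the hurdle
-- condition makes σ firable wherever t is, and Δ(σ) = Δ(t) makes it end in the same marking.
-- A redundant place p satisfies the invariant v(p)·p = Σ v(q)·q + b, which is the added marking
-- equation; the inequality on Pre(t) makes t enabled on p whenever it is enabled on I, so p never
-- blocks a transition. A source-sink pair only removes tokens from p, and firing t lowers p to any
-- value below m0(p). For an agglomeration, collapsing the places of A into a maps runs of the net
-- onto runs of the agglomerated net; conversely, before each firing the tokens counted by a are
-- redistributed inside A, freely around a loop and along t from p to q in a chain.
module Submission where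

open import Defs

open import Data.Bool using (if_then_else_)
open import Data.Empty using (⊥-elim)
open import Data.Integer as ℤ using (ℤ; +_)
import Data.Integer.Properties as ℤ
import Data.Integer.Tactic.RingSolver as ℤ-Ring
open import Data.List using (List; []; _∷_; _++_; map; foldl; drop)
open import Data.List.Properties using (map-cong-local)
open import Data.List.Membership.Propositional using (_∈_; _∉_)
open import Data.List.Membership.Propositional.Properties
  using (∈-filter⁺; ∈-filter⁻; ∈-++⁺ˡ; ∈-++⁺ʳ; ∈-map⁺)
open import Data.List.Membership.Propositional.Properties.WithK using (unique∧set⇒bag)
open import Data.List.Relation.Binary.BagAndSetEquality using (∼bag⇒↭)
open import Data.List.Relation.Binary.Permutation.Propositional using (_↭_)
import Data.List.Relation.Binary.Permutation.Propositional.Properties as ↭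
open import Data.List.Relation.Unary.Any using (here; there)
open import Data.List.Relation.Unary.All as All using (All; []; _∷_)
import Data.List.Relation.Unary.All.Properties as All
open import Data.List.Relation.Unary.AllPairs using ([]; _∷_)
open import Data.List.Relation.Unary.Unique.Propositional using (Unique)
open import Data.Nat using (ℕ; zero; suc; _+_; _*_; _∸_; _≤_; _<_; _≟_; _≤?_; z≤n; s≤s; NonZero; >-nonZero)
open import Data.Nat.Properties
open import Algebra.Properties.CommutativeSemigroup +-commutativeSemigroup
  using (interchange; x∙yz≈xz∙y; xy∙z≈x∙zy; xy∙z≈zy∙x)
open import Data.Nat.ListAction using (sum)
open import Data.Nat.ListAction.Properties using (sum-↭)
open import Data.List.Membership.DecPropositional _≟_ using (_∈?_)
open import Data.Product using (∃-syntax; _×_; _,_; proj₁; proj₂; uncurry)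
open import Data.Sum using (_⊎_; inj₁; inj₂)
open import Data.Unit using (⊤; tt)
open import Function.Base using (id; _∘_)
open import Function.Bundles using (_⇔_; mk⇔; Equivalence)
open import Function.Properties.Equivalence using () renaming (trans to ⇔-trans; sym to ⇔-sym)
open import Relation.Nullary using (¬_; yes; no)
open import Relation.Nullary.Decidable using (¬?; ⌊_⌋)
open import Relation.Binary.PropositionalEquality
  using (_≡_; _≢_; refl; sym; cong; cong₂; subst; subst₂; module ≡-Reasoning)
  renaming (trans to ≡-trans)

_≗[_]_ : Marking → List Name → Marking → Set
x ≗[ P ] y = ∀ p → p ∈ P → x p ≡ y p

≗-sym : ∀ {P x y} → x ≗[ P ] y → y ≗[ P ] x
≗-sym x≗y p p∈ = sym (x≗y p p∈)

update : Marking → Name → ℕ → Marking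
update m p n q = if ⌊ q ≟ p ⌋ then n else m q

update-≡ : ∀ m p n → update m p n p ≡ n
update-≡ m p n with p ≟ p
... | yes _ = refl
... | no p≢p = ⊥-elim (p≢p refl)

update-≢ : ∀ m {p} n {q} → q ≢ p → update m p n q ≡ m q
update-≢ m {p} n {q} q≢p with q ≟ p
... | yes q≡p = ⊥-elim (q≢p q≡p)
... | no _ = refl

split-at : ∀ {ℓ} {X : Name → Set ℓ} p → X p → (∀ q → q ≢ p → X q) → ∀ q → X q
split-at p Xp Xq q with q ≟ p
... | yes refl = Xp
... | no q≢p   = Xq q q≢p

split-at₂ : ∀ {X : Name → Set} r s → X r → X s → (∀ n → n ≢ r → n ≢ s → X n) → ∀ n → X n
split-at₂ {X} r s Xr Xs Xn = split-at r Xr λ n n≢r → split-at {X = λ n → n ≢ r → X n} s (λ _ → Xs)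
  (λ n n≢s n≢r → Xn n n≢r n≢s) n n≢r

≮0⇒≡0 : ∀ {n} → ¬ (0 < n) → n ≡ 0
≮0⇒≡0 0≮n = n≤0⇒n≡0 (≮⇒≥ 0≮n)

∈∧∉⇒≢ : ∀ {L : List Name} {x y} → x ∈ L → y ∉ L → x ≢ y
∈∧∉⇒≢ x∈L y∉L refl = y∉L x∈L

∸+-cong : ∀ {m m' n n' o o' : ℕ} → m ≡ m' → n ≡ n' → o ≡ o' → (m ∸ n) + o ≡ (m' ∸ n') + o'
∸+-cong refl refl refl = refl

settle : Marking → Name → ℕ → Name → ℕ → Marking
settle x r v s d = update (update x r v) s (x s + d)

settle-r : ∀ x {r} v {s} d → r ≢ s → settle x r v s d r ≡ v
settle-r x {r} v {s} d r≢s = ≡-trans (update-≢ (update x r v) _ r≢s) (update-≡ x r v)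

settle-s : ∀ x r v s d → settle x r v s d s ≡ x s + d
settle-s x r v s d = update-≡ (update x r v) s _

settle-≢ : ∀ x {r} v {s} d {n} → n ≢ r → n ≢ s → settle x r v s d n ≡ x n
settle-≢ x {r} v {s} d n≢r n≢s = ≡-trans (update-≢ (update x r v) _ n≢s) (update-≢ x v n≢r)

sumOver-cong : ∀ L {f g : Name → ℕ} → (∀ q → q ∈ L → f q ≡ g q) → sumOver L f ≡ sumOver L g
sumOver-cong L f≗g = cong sum (map-cong-local (All.tabulate λ {q} → f≗g q))

sumOver-mono : ∀ L {f g : Name → ℕ} → (∀ q → q ∈ L → f q ≤ g q) → sumOver L f ≤ sumOver L g
sumOver-mono []      f≤g = z≤n
sumOver-mono (q ∷ L) f≤g = +-mono-≤ (f≤g q (here refl)) (sumOver-mono L λ r r∈ → f≤g r (there r∈))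

sumOver-+ : ∀ L (f g : Name → ℕ) → sumOver L (λ q → f q + g q) ≡ sumOver L f + sumOver L g
sumOver-+ []      f g = refl
sumOver-+ (q ∷ L) f g = ≡-trans (cong (_+_ (f q + g q)) (sumOver-+ L f g)) (interchange (f q) (g q) _ _)

sumOver-∸ : ∀ L (f g : Name → ℕ) → (∀ q → q ∈ L → g q ≤ f q) →
  sumOver L (λ q → f q ∸ g q) ≡ sumOver L f ∸ sumOver L g
sumOver-∸ L f g g≤f = begin
  sumOver L (λ q → f q ∸ g q)                               ≡⟨ m+n∸n≡m _ (sumOver L g) ⟨
  (sumOver L (λ q → f q ∸ g q) + sumOver L g) ∸ sumOver L g ≡⟨ cong (_∸ sumOver L g) (sumOver-+ L _ g) ⟨
  sumOver L (λ q → (f q ∸ g q) + g q) ∸ sumOver L g         ≡⟨ cong (_∸ sumOver L g)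
                                                                    (sumOver-cong L λ q q∈ → m∸n+n≡m (g≤f q q∈)) ⟩
  sumOver L f ∸ sumOver L g                                 ∎
  where open ≡-Reasoning

sumOver-change : ∀ T {y y' : Marking} {s} → Unique T → s ∈ T → (∀ n → n ∈ T → n ≢ s → y' n ≡ y n) →
  sumOver T y' + y s ≡ sumOver T y + y' s
sumOver-change (x ∷ T) {y} {y'} (x∉T ∷ _) (here refl) same = begin
  (y' x + sumOver T y') + y x  ≡⟨ cong (λ k → (y' x + k) + y x)
                                       (sumOver-cong T λ n n∈ → same n (there n∈) (All.lookup x∉T n∈ ∘ sym)) ⟩
  (y' x + sumOver T y) + y x   ≡⟨ xy∙z≈zy∙x (y' x) (sumOver T y) (y x) ⟩
  (y x + sumOver T y) + y' x   ∎
  where open ≡-Reasoning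
sumOver-change (x ∷ T) {y} {y'} {s} (x∉T ∷ T!) (there s∈T) same = begin
  (y' x + sumOver T y') + y s  ≡⟨ +-assoc (y' x) _ _ ⟩
  y' x + (sumOver T y' + y s)  ≡⟨ cong₂ _+_ (same x (here refl) (All.lookup x∉T s∈T))
                                           (sumOver-change T T! s∈T λ n n∈ → same n (there n∈)) ⟩
  y x + (sumOver T y + y' s)   ≡⟨ +-assoc (y x) _ _ ⟨
  (y x + sumOver T y) + y' s   ∎
  where open ≡-Reasoning

sumOver-settle : ∀ T x {r} v {s} d → Unique T → r ∉ T → s ∈ T →
                 sumOver T (settle x r v s d) ≡ sumOver T x + d
sumOver-settle T x {r} v {s} d T! r∉T s∈T = +-cancelʳ-≡ (x s) _ _ (begin
  sumOver T (settle x r v s d) + x s  ≡⟨ sumOver-change T T! s∈T (λ n n∈ n≢s →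
                                           settle-≢ x v d (∈∧∉⇒≢ n∈ r∉T) n≢s) ⟩
  sumOver T x + settle x r v s d s    ≡⟨ cong (_+_ (sumOver T x)) (settle-s x r v s d) ⟩
  sumOver T x + (x s + d)             ≡⟨ x∙yz≈xz∙y (sumOver T x) (x s) d ⟩
  (sumOver T x + d) + x s             ∎)
  where open ≡-Reasoning

sumOver-pair : ∀ A {p q} → Unique A → p ≢ q → (∀ r → (r ∈ A) ⇔ (r ≡ p ⊎ r ≡ q)) →
               ∀ f → sumOver A f ≡ f p + f q
sumOver-pair A {p} {q} A! p≢q A≡pq f = ≡-trans (sum-↭ (↭.map⁺ f A↭pq)) (cong (_+_ (f p)) (+-identityʳ (f q)))
  where
  pq : ∀ {r} → (r ∈ p ∷ q ∷ []) ⇔ (r ≡ p ⊎ r ≡ q)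
  pq = mk⇔ (λ { (here r≡p) → inj₁ r≡p ; (there (here r≡q)) → inj₂ r≡q })
           (λ { (inj₁ r≡p) → here r≡p ; (inj₂ r≡q) → there (here r≡q) })
  A↭pq : A ↭ p ∷ q ∷ []
  A↭pq = ∼bag⇒↭ (unique∧set⇒bag A! ((p≢q ∷ []) ∷ [] ∷ []) λ {r} → ⇔-trans (A≡pq r) (⇔-sym pq))

Reach-resp : ∀ {N m m'} → Reach N m → m ≗[ places N ] m' → Reach N m'
Reach-resp (init m≗m0) m≗m' = init λ p p∈ → ≡-trans (sym (m≗m' p p∈)) (m≗m0 p p∈)
Reach-resp (step t t∈ r en m≗fire) m≗m' =
  step t t∈ r en λ p p∈ → ≡-trans (sym (m≗m' p p∈)) (m≗fire p p∈)

Enabled-resp : ∀ {N t m m'} → Enabled N t m → m ≗[ places N ] m' → Enabled N t m'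
Enabled-resp en m≗m' p p∈ = subst (_ ≤_) (m≗m' p p∈) (en p p∈)

fire-resp : ∀ {N} t {m m'} → m ≗[ places N ] m' → fire N t m ≗[ places N ] fire N t m'
fire-resp {N} t m≗m' p p∈ = cong (λ k → (k ∸ pre N t p) + post N t p) (m≗m' p p∈)

sumOver-fire : ∀ L {N u m} → (∀ q → q ∈ L → pre N u q ≤ m q) →
  sumOver L (fire N u m) ≡ (sumOver L m ∸ sumOver L (pre N u)) + sumOver L (post N u)
sumOver-fire L {N} {u} {m} en = ≡-trans (sumOver-+ L (λ q → m q ∸ pre N u q) (post N u))
                                        (cong (_+ sumOver L (post N u)) (sumOver-∸ L m (pre N u) en))

∈-removePlace⁺ : ∀ N {p q} → q ∈ places N → q ≢ p → q ∈ places (removePlace N p)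
∈-removePlace⁺ N {p} = ∈-filter⁺ (λ q → ¬? (q ≟ p))

∈-removePlace⁻ : ∀ N {p q} → q ∈ places (removePlace N p) → q ∈ places N × q ≢ p
∈-removePlace⁻ N {p} = ∈-filter⁻ (λ q → ¬? (q ≟ p)) {xs = places N}

∈-removeTransition⁺ : ∀ N {t u} → u ∈ trans N → u ≢ t → u ∈ trans (removeTransition N t)
∈-removeTransition⁺ N {t} = ∈-filter⁺ (λ u → ¬? (u ≟ t))

∈-removeTransition⁻ : ∀ N {t u} → u ∈ trans (removeTransition N t) → u ∈ trans N × u ≢ t
∈-removeTransition⁻ N {t} = ∈-filter⁻ (λ u → ¬? (u ≟ t)) {xs = trans N}

pos-∸ : ∀ {m n} → n ≤ m → + (m ∸ n) ≡ + m ℤ.- + n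
pos-∸ {m} {n} n≤m = ≡-trans (sym (ℤ.⊖-≥ n≤m)) (sym (ℤ.m-n≡m⊖n m n))

pos-fire : ∀ N t m p → pre N t p ≤ m p → + fire N t m p ≡ + m p ℤ.+ Δt N t p
pos-fire N t m p en = begin
  + ((m p ∸ pre N t p) + post N t p)               ≡⟨ ℤ.pos-+ (m p ∸ pre N t p) (post N t p) ⟩
  + (m p ∸ pre N t p) ℤ.+ + post N t p             ≡⟨ cong (ℤ._+ + post N t p) (pos-∸ en) ⟩
  (+ m p ℤ.- + pre N t p) ℤ.+ + post N t p         ≡⟨ ℤ.+-assoc (+ m p) (ℤ.- + pre N t p) (+ post N t p) ⟩
  + m p ℤ.+ (ℤ.- + pre N t p ℤ.+ + post N t p)     ≡⟨ cong (ℤ._+_ (+ m p)) (ℤ.+-comm (ℤ.- + pre N t p) _) ⟩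
  + m p ℤ.+ (+ post N t p ℤ.- + pre N t p)         ∎
  where open ≡-Reasoning

i≡j+[i-j] : ∀ (i j : ℤ) → i ≡ j ℤ.+ (i ℤ.- j)
i≡j+[i-j] = ℤ-Ring.solve-∀

i≡[i-j]+j : ∀ (i j : ℤ) → i ≡ (i ℤ.- j) ℤ.+ j
i≡[i-j]+j = ℤ-Ring.solve-∀

pos-sub-≡ : ∀ {m n k} → + m ℤ.- + n ≡ + k → m ≡ n + k
pos-sub-≡ {m} {n} {k} m-n≡k = ℤ.+-injective (begin
  + m                       ≡⟨ i≡j+[i-j] (+ m) (+ n) ⟩
  + n ℤ.+ (+ m ℤ.- + n)     ≡⟨ cong (ℤ._+_ (+ n)) m-n≡k ⟩
  + n ℤ.+ + k               ≡⟨ ℤ.pos-+ n k ⟨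
  + (n + k)                 ∎)
  where open ≡-Reasoning

pos-sub-≤ : ∀ {m n k} → + m ℤ.- + n ℤ.≤ + k → m ≤ k + n
pos-sub-≤ {m} {n} {k} m-n≤k = ℤ.drop‿+≤+ (subst₂ ℤ._≤_ (sym (i≡[i-j]+j (+ m) (+ n))) (sym (ℤ.pos-+ k n))
                                                    (ℤ.+-monoˡ-≤ (+ n) m-n≤k))

pos-*-fire : ∀ N u y q c → pre N u q ≤ y q → + (c * fire N u y q) ≡ + (c * y q) ℤ.+ + c ℤ.* Δt N u q
pos-*-fire N u y q c en = begin
  + (c * fire N u y q)              ≡⟨ ℤ.pos-* c (fire N u y q) ⟩
  + c ℤ.* + fire N u y q            ≡⟨ cong (ℤ._*_ (+ c)) (pos-fire N u y q en) ⟩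
  + c ℤ.* (+ y q ℤ.+ Δt N u q)      ≡⟨ ℤ.*-distribˡ-+ (+ c) (+ y q) (Δt N u q) ⟩
  + c ℤ.* + y q ℤ.+ + c ℤ.* Δt N u q ≡⟨ cong (ℤ._+ + c ℤ.* Δt N u q) (ℤ.pos-* c (y q)) ⟨
  + (c * y q) ℤ.+ + c ℤ.* Δt N u q  ∎
  where open ≡-Reasoning

pos-sumOver-fire : ∀ N u y L (w : Name → ℕ) → (∀ q → q ∈ L → pre N u q ≤ y q) →
  + sumOver L (λ q → w q * fire N u y q) ≡
  + sumOver L (λ q → w q * y q) ℤ.+ sumOverℤ L (λ q → + w q ℤ.* Δt N u q)
pos-sumOver-fire N u y []      w _  = refl
pos-sumOver-fire N u y (q ∷ L) w en = begin
  + (w q * fire N u y q + F)        ≡⟨ ℤ.pos-+ (w q * fire N u y q) F ⟩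
  + (w q * fire N u y q) ℤ.+ + F    ≡⟨ cong₂ ℤ._+_ (pos-*-fire N u y q (w q) (en q (here refl)))
                                                    (pos-sumOver-fire N u y L w λ r r∈ → en r (there r∈)) ⟩
  (+ (w q * y q) ℤ.+ d) ℤ.+ (+ S ℤ.+ D)  ≡⟨ swap (+ (w q * y q)) d (+ S) D ⟩
  (+ (w q * y q) ℤ.+ + S) ℤ.+ (d ℤ.+ D)  ≡⟨ cong (ℤ._+ (d ℤ.+ D)) (ℤ.pos-+ (w q * y q) S) ⟨
  + (w q * y q + S) ℤ.+ (d ℤ.+ D)   ∎
  where
  open ≡-Reasoning
  F S : ℕ
  F = sumOver L (λ q → w q * fire N u y q)
  S = sumOver L (λ q → w q * y q)
  d D : ℤ
  d = + w q ℤ.* Δt N u q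
  D = sumOverℤ L (λ q → + w q ℤ.* Δt N u q)
  swap : ∀ (a b c e : ℤ) → (a ℤ.+ b) ℤ.+ (c ℤ.+ e) ≡ (a ℤ.+ c) ℤ.+ (b ℤ.+ e)
  swap = ℤ-Ring.solve-∀

≡-⇔ : ∀ {a a' b b' : ℕ} → a ≡ a' → b ≡ b' → (a ≡ b) ⇔ (a' ≡ b')
≡-⇔ refl refl = mk⇔ id id

lin-weighted : ∀ (v : Name → ℕ) I x → lin (map (λ q → (v q , q)) I) x ≡ sumOver I (λ q → v q * x q)
lin-weighted v []      x = refl
lin-weighted v (q ∷ I) x = cong (_+_ (v q * x q)) (lin-weighted v I x)

lin-unit : ∀ A x → lin (map (λ q → (1 , q)) A) x ≡ sumOver A x
lin-unit A x = ≡-trans (lin-weighted _ A x) (sumOver-cong A λ q _ → *-identityˡ (x q))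

holds-markingEq : ∀ {p I v b x} →
  Holds (markingEq p I v b) x ⇔ (v p * x p ≡ sumOver I (λ q → v q * x q) + b)
holds-markingEq {p} {I} {v} {b} {x} =
  ≡-⇔ (≡-trans (+-identityʳ _) (+-identityʳ _)) (cong (_+ b) (lin-weighted v I x))

holds-sumEq : ∀ {a A x} → Holds (sumEq a A) x ⇔ (x a ≡ sumOver A x)
holds-sumEq {a} {A} {x} =
  ≡-⇔ (≡-trans (+-identityʳ _) (≡-trans (+-identityʳ _) (*-identityˡ (x a))))
      (≡-trans (+-identityʳ _) (lin-unit A x))

holds-leEq : ∀ {p k x} → Holds (leEq p k) x ⇔ (x p ≤ k)
holds-leEq {p} {k} {x} = mk⇔ (subst (_≤ k) x≡) (subst (_≤ k) (sym x≡))
  where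
  x≡ : (1 * x p + 0) + 0 ≡ x p
  x≡ = ≡-trans (+-identityʳ _) (≡-trans (+-identityʳ _) (*-identityˡ (x p)))

Sat-⨾⁺ : ∀ {Q c x} → Sat Q x → Holds c x → Sat (Q ⨾ c) x
Sat-⨾⁺ sQ hc = All.++⁺ sQ (hc ∷ [])

Sat-⨾⁻ : ∀ Q {c x} → Sat (Q ⨾ c) x → Sat Q x × Holds c x
Sat-⨾⁻ Q s with All.++⁻ Q s
... | sQ , (hc ∷ []) = sQ , hc

lin-resp : ∀ ts {x y} → (∀ c q → (c , q) ∈ ts → x q ≡ y q) → lin ts x ≡ lin ts y
lin-resp ts x≗y = cong sum (map-cong-local {xs = ts} (All.tabulate λ { {c , q} cq∈ → cong (c *_) (x≗y c q cq∈) }))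

Sat-resp : ∀ Q {x y} → (∀ q → q ∈ vars Q → x q ≡ y q) → Sat Q x → Sat Q y
Sat-resp []      _   []        = []
Sat-resp (c ∷ Q) x≗y (hc ∷ hQ) =
  subst₂ (holdsRel (rel c))
    (cong (_+ lcst c) (lin-resp (lhs c) λ k q kq∈ → x≗y q (in-c (∈-++⁺ˡ kq∈))))
    (cong (_+ rcst c) (lin-resp (rhs c) λ k q kq∈ → x≗y q (in-c (∈-++⁺ʳ (lhs c) kq∈)))) hc
  ∷ Sat-resp Q (λ q q∈ → x≗y q (∈-++⁺ʳ _ q∈)) hQ
  where
  in-c : ∀ {k q} → (k , q) ∈ lhs c ++ rhs c → q ∈ vars (c ∷ Q)
  in-c kq∈ = ∈-++⁺ˡ (∈-map⁺ _ kq∈)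

NetAbstraction-refl : ∀ N → NetAbstraction N [] N
NetAbstraction-refl N m = mk⇔ (λ r → m , r , [] , λ _ _ → refl) λ { (x , rx , _ , x≗m) → Reach-resp rx x≗m }

Reproduces : List Name → Net → System → Net → System → Set
Reproduces P N Q N' Q' =
  ∀ x → Reach N x → Sat Q x → ∃[ x' ] (Reach N' x' × Sat Q' x' × x ≗[ P ] x')

reproduces-identically : ∀ {P N Q N' Q'} →
  (∀ {x} → Reach N x → Sat Q x → Reach N' x × Sat Q' x) → Reproduces P N Q N' Q'
reproduces-identically f x r s = x , proj₁ (f r s) , proj₂ (f r s) , λ _ _ → refl

NetAbstraction-transport : ∀ {N1 Q N2 Q' N3} →
  Reproduces (places N1) N2 Q N3 Q' → Reproduces (places N1) N3 Q' N2 Q →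
  NetAbstraction N1 Q N2 → NetAbstraction N1 Q' N3
NetAbstraction-transport {N1} {Q} {N2} {Q'} {N3} to₃ to₂ abs m = mk⇔ forth back
  where
  glue : ∀ {x x'} → x ≗[ places N1 ] x' → x ≗[ places N1 ] m → x' ≗[ places N1 ] m
  glue x≗x' x≗m p p∈ = ≡-trans (sym (x≗x' p p∈)) (x≗m p p∈)
  forth : Reach N1 m → ∃[ x' ] (Reach N3 x' × Sat Q' x' × x' ≗[ places N1 ] m)
  forth r with Equivalence.to (abs m) r
  ... | x , rx , sx , x≗m with to₃ x rx sx
  ... | x' , rx' , sx' , x≗x' = x' , rx' , sx' , glue x≗x' x≗m
  back : ∃[ x' ] (Reach N3 x' × Sat Q' x' × x' ≗[ places N1 ] m) → Reach N1 m
  back (x' , rx' , sx' , x'≗m) with to₂ x' rx' sx'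
  ... | x , rx , sx , x'≗x = Equivalence.from (abs m) (x , rx , sx , glue x'≗x x'≗m)

-- Redundant transitions

-- A left fold, so that firing sequences of removeTransition N t and of N agree definitionally.
fireSeq : Net → List Name → Marking → Marking
fireSeq N σ m = foldl (λ m t → fire N t m) m σ

Reach-fireSeq : ∀ {N m} σ → All (_∈ trans N) σ → Firable N σ m → Reach N m → Reach N (fireSeq N σ m)
Reach-fireSeq []      _           _          r = r
Reach-fireSeq (t ∷ σ) (t∈ ∷ σ⊆T) (en , fir) r = Reach-fireSeq σ σ⊆T fir (step t t∈ r en λ _ _ → refl)

Firable-mono : ∀ {N h m} σ → Firable N σ h → (∀ p → p ∈ places N → h p ≤ m p) → Firable N σ m
Firable-mono []          _          _   = tt
Firable-mono {N} (t ∷ σ) (en , fir) h≤m =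
  (λ p p∈ → ≤-trans (en p p∈) (h≤m p p∈)) ,
  Firable-mono σ fir λ p p∈ → +-monoˡ-≤ (post N t p) (∸-monoˡ-≤ (pre N t p) (h≤m p p∈))

Firable-removeTransition : ∀ {N u m} σ → Firable N σ m → Firable (removeTransition N u) σ m
Firable-removeTransition []      _          = tt
Firable-removeTransition (t ∷ σ) (en , fir) = en , Firable-removeTransition σ fir

pos-fireSeq : ∀ N σ m → Firable N σ m → ∀ p → p ∈ places N → + fireSeq N σ m p ≡ + m p ℤ.+ Δ N σ p
pos-fireSeq N []      m _          p _  = sym (ℤ.+-identityʳ _)
pos-fireSeq N (t ∷ σ) m (en , fir) p p∈ = begin
  + fireSeq N σ (fire N t m) p          ≡⟨ pos-fireSeq N σ (fire N t m) fir p p∈ ⟩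
  + fire N t m p ℤ.+ Δ N σ p            ≡⟨ cong (ℤ._+ Δ N σ p) (pos-fire N t m p (en p p∈)) ⟩
  (+ m p ℤ.+ Δt N t p) ℤ.+ Δ N σ p      ≡⟨ ℤ.+-assoc (+ m p) (Δt N t p) (Δ N σ p) ⟩
  + m p ℤ.+ Δ N (t ∷ σ) p               ∎
  where open ≡-Reasoning

redundant-replacement : ∀ {N t m} → RedundantTransition N t → Enabled N t m →
  ∃[ σ ] (All (λ u → u ∈ trans N × u ≢ t) σ × Firable N σ m × fireSeq N σ m ≗[ places N ] fire N t m)
redundant-replacement {N} {t} {m} (_ , σ , σ⊆T , Δσ≡Δt , _ , _ , (hσ-fir , _) , (_ , ht-least) , hσ≤ht) en =
  σ , σ⊆T , σ-fir , λ p p∈ → ℤ.+-injective (begin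
    + fireSeq N σ m p     ≡⟨ pos-fireSeq N σ m σ-fir p p∈ ⟩
    + m p ℤ.+ Δ N σ p     ≡⟨ cong (ℤ._+_ (+ m p)) (Δσ≡Δt p p∈) ⟩
    + m p ℤ.+ Δt N t p    ≡⟨ pos-fire N t m p (en p p∈) ⟨
    + fire N t m p        ∎)
  where
  open ≡-Reasoning
  σ-fir : Firable N σ m
  σ-fir = Firable-mono σ hσ-fir λ p p∈ → ≤-trans (hσ≤ht p p∈) (ht-least m (en , tt) p p∈)

Reach-removeTransition⁺ : ∀ {N t x} → RedundantTransition N t → Reach N x → Reach (removeTransition N t) x
Reach-removeTransition⁺ red (init x≗m0) = init x≗m0
Reach-removeTransition⁺ {N} {t} red (step u u∈ r en m'≗fire) with u ≟ t
... | no u≢t = step u (∈-removeTransition⁺ N u∈ u≢t) (Reach-removeTransition⁺ red r) en m'≗fire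
... | yes refl with redundant-replacement red en
...   | σ , σ⊆T , σ-fir , σ≗t =
  Reach-resp (Reach-fireSeq σ (All.map (λ (u∈ , u≢t) → ∈-removeTransition⁺ N u∈ u≢t) σ⊆T)
                            (Firable-removeTransition σ σ-fir) (Reach-removeTransition⁺ red r))
             λ p p∈ → ≡-trans (σ≗t p p∈) (sym (m'≗fire p p∈))

Reach-removeTransition⁻ : ∀ {N t x} → Reach (removeTransition N t) x → Reach N x
Reach-removeTransition⁻ (init x≗m0) = init x≗m0
Reach-removeTransition⁻ {N} {t} (step u u∈ r en m'≗fire) =
  step u (proj₁ (∈-removeTransition⁻ N u∈)) (Reach-removeTransition⁻ r) en m'≗fire

NetAbstraction-removeTransition : ∀ {N1 Q N2 t} → NetAbstraction N1 Q N2 → RedundantTransition N2 t →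
  NetAbstraction N1 Q (removeTransition N2 t)
NetAbstraction-removeTransition abs red = NetAbstraction-transport
  (reproduces-identically λ r s → Reach-removeTransition⁺ red r , s)
  (reproduces-identically λ r s → Reach-removeTransition⁻ r , s)
  abs

-- Redundant places

module RedundantPlaceRemoval {N : Net} {p : Name} {I : List Name} {v : Name → ℕ} {b : ℕ}
  (p∈P : p ∈ places N)
  (I⊆P : All (λ q → q ∈ places N × q ≢ p) I)
  (v-p>0 : 0 < v p)
  (b-init : + b ≡ + (v p * m0 N p) ℤ.- + sumOver I (λ q → v q * m0 N q))
  (t-cond : ∀ t → t ∈ trans N →
     (+ (v p * pre N t p) ℤ.- + sumOver I (λ q → v q * pre N t q) ℤ.≤ + b)
     × (+ v p ℤ.* Δt N t p ≡ sumOverℤ I (λ q → + v q ℤ.* Δt N t q))) where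

  N' : Net
  N' = removePlace N p

  instance
    v-p-nonZero : NonZero (v p)
    v-p-nonZero = >-nonZero v-p>0

  weighted : Marking → ℕ
  weighted y = sumOver I (λ q → v q * y q)

  Balanced : Marking → Set
  Balanced y = + (v p * y p) ℤ.- + weighted y ≡ + b

  I⊆P' : ∀ {q} → q ∈ I → q ∈ places N'
  I⊆P' q∈I = let q∈P , q≢p = All.lookup I⊆P q∈I in ∈-removePlace⁺ N q∈P q≢p

  weighted-resp : ∀ {y y'} → (∀ q → q ∈ I → y q ≡ y' q) → weighted y ≡ weighted y'
  weighted-resp y≗y' = sumOver-cong I λ q q∈ → cong (v q *_) (y≗y' q q∈)

  Balanced-resp : ∀ {y y'} → y ≗[ places N ] y' → Balanced y → Balanced y'
  Balanced-resp y≗y' = ≡-trans (cong₂ (λ k w → + (v p * k) ℤ.- + w)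
    (sym (y≗y' p p∈P)) (sym (weighted-resp λ q q∈ → y≗y' q (proj₁ (All.lookup I⊆P q∈)))))

  Balanced⇒markingEq : ∀ {y} → Balanced y → v p * y p ≡ weighted y + b
  Balanced⇒markingEq = pos-sub-≡

  Balanced-fire : ∀ {u y} → u ∈ trans N → Enabled N u y → Balanced y → Balanced (fire N u y)
  Balanced-fire {u} {y} u∈ en balanced = begin
    + (v p * fire N u y p) ℤ.- + weighted (fire N u y)
      ≡⟨ cong₂ ℤ._-_ (pos-*-fire N u y p (v p) (en p p∈P))
                     (pos-sumOver-fire N u y I v λ q q∈ → en q (proj₁ (All.lookup I⊆P q∈))) ⟩
    (+ (v p * y p) ℤ.+ + v p ℤ.* Δt N u p) ℤ.- (+ weighted y ℤ.+ D)
      ≡⟨ cong (λ d → (+ (v p * y p) ℤ.+ d) ℤ.- (+ weighted y ℤ.+ D)) (proj₂ (t-cond u u∈)) ⟩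
    (+ (v p * y p) ℤ.+ D) ℤ.- (+ weighted y ℤ.+ D)
      ≡⟨ cancel (+ (v p * y p)) (+ weighted y) D ⟩
    + (v p * y p) ℤ.- + weighted y
      ≡⟨ balanced ⟩
    + b ∎
    where
    open ≡-Reasoning
    D : ℤ
    D = sumOverℤ I (λ q → + v q ℤ.* Δt N u q)
    cancel : ∀ (i j k : ℤ) → (i ℤ.+ k) ℤ.- (j ℤ.+ k) ≡ i ℤ.- j
    cancel = ℤ-Ring.solve-∀

  Enabled-p : ∀ {u y} → u ∈ trans N → Balanced y → (∀ q → q ∈ I → pre N u q ≤ y q) → pre N u p ≤ y p
  Enabled-p {u} {y} u∈ balanced en-I = *-cancelˡ-≤ (v p) (begin
    v p * pre N u p        ≤⟨ pos-sub-≤ (proj₁ (t-cond u u∈)) ⟩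
    b + weighted (pre N u) ≤⟨ +-monoʳ-≤ b (sumOver-mono I λ q q∈ → *-monoʳ-≤ (v q) (en-I q q∈)) ⟩
    b + weighted y         ≡⟨ +-comm b (weighted y) ⟩
    weighted y + b         ≡⟨ Balanced⇒markingEq balanced ⟨
    v p * y p              ∎)
    where open ≤-Reasoning

  Reach⁺ : ∀ {x} → Reach N x → Reach N' x × Balanced x
  Reach⁺ (init x≗m0) =
    init (λ q q∈ → x≗m0 q (proj₁ (∈-removePlace⁻ N q∈))) ,
    Balanced-resp (λ q q∈ → sym (x≗m0 q q∈)) (sym b-init)
  Reach⁺ (step u u∈ r en m'≗fire) =
    let r' , balanced = Reach⁺ r in
    step u u∈ r' (λ q q∈ → en q (proj₁ (∈-removePlace⁻ N q∈)))
                 (λ q q∈ → m'≗fire q (proj₁ (∈-removePlace⁻ N q∈))) ,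
    Balanced-resp (λ q q∈ → sym (m'≗fire q q∈)) (Balanced-fire u∈ en balanced)

  Reach⁻ : ∀ {y} → Reach N' y → ∃[ y' ] (Reach N y' × y ≗[ places N' ] y' × Balanced y')
  Reach⁻ (init y≗m0) = m0 N , init (λ _ _ → refl) , y≗m0 , sym b-init
  Reach⁻ (step {m} {m'} u u∈ r en m'≗fire) =
    let y' , r' , m≗y' , balanced = Reach⁻ r
        en' : Enabled N u y'
        en' = split-at p (λ _ → Enabled-p u∈ balanced λ q q∈I → Enabled-resp {N'} en m≗y' q (I⊆P' q∈I))
                λ q q≢p q∈ → Enabled-resp {N'} en m≗y' q (∈-removePlace⁺ N q∈ q≢p)
    in fire N u y' , step u u∈ r' en' (λ _ _ → refl) ,
       (λ q q∈ → ≡-trans (m'≗fire q q∈) (fire-resp {N'} u m≗y' q q∈)) ,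
       Balanced-fire u∈ en' balanced

  Reach⁻-markingEq : ∀ {x} → Reach N' x → v p * x p ≡ weighted x + b → Reach N x
  Reach⁻-markingEq {x} r x-eq =
    let y' , r' , x≗y' , balanced = Reach⁻ r in
    Reach-resp r' (split-at p (λ _ → *-cancelˡ-≡ _ _ (v p) (begin
        v p * y' p       ≡⟨ Balanced⇒markingEq balanced ⟩
        weighted y' + b  ≡⟨ cong (_+ b) (weighted-resp λ q q∈ → x≗y' q (I⊆P' q∈)) ⟨
        weighted x + b   ≡⟨ x-eq ⟨
        v p * x p        ∎))
      λ q q≢p q∈ → sym (x≗y' q (∈-removePlace⁺ N q∈ q≢p)))
    where open ≡-Reasoning

NetAbstraction-removePlace : ∀ {N1 Q N2 p I v b} → NetAbstraction N1 Q N2 → RedundantPlace N2 p I v b →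
  NetAbstraction N1 (Q ⨾ markingEq p I v b) (removePlace N2 p)
NetAbstraction-removePlace {Q = Q} {N2} {p} {I} {v} {b} abs (p∈P , _ , I⊆P , v-p>0 , _ , b-init , t-cond) =
  NetAbstraction-transport
    (reproduces-identically λ {x} r s → let r' , balanced = Reach⁺ r in
      r' , Sat-⨾⁺ s (Equivalence.from (holds-markingEq {p} {I} {v} {b} {x}) (Balanced⇒markingEq balanced)))
    (reproduces-identically λ {x} r s → let sQ , hc = Sat-⨾⁻ Q s in
      Reach⁻-markingEq r (Equivalence.to (holds-markingEq {p} {I} {v} {b} {x}) hc) , sQ)
    abs
  where open RedundantPlaceRemoval {N2} {p} {I} {v} {b} p∈P I⊆P v-p>0 b-init t-cond

-- Source-sink pairs

module SourceSinkRemoval {N : Net} {p t : Name}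
  (p∈P : p ∈ places N) (t∈T : t ∈ trans N)
  (•p-empty : ∀ u → u ∈ trans N → post N u p ≡ 0)
  (p•-t : ∀ u → u ∈ trans N → (0 < pre N u p) ⇔ (u ≡ t))
  (pre-t-p : pre N t p ≡ 1) (pre-t-≢ : ∀ r → r ∈ places N → r ≢ p → pre N t r ≡ 0)
  (post-t : ∀ r → r ∈ places N → post N t r ≡ 0) where

  N' : Net
  N' = removeSourceSink N p t

  fire-t-p : ∀ w → fire N t w p ≡ w p ∸ 1
  fire-t-p w = ≡-trans (∸+-cong refl pre-t-p (post-t p p∈P)) (+-identityʳ _)

  fire-t-≢ : ∀ w {q} → q ∈ places N → q ≢ p → fire N t w q ≡ w q
  fire-t-≢ w {q} q∈ q≢p = ≡-trans (∸+-cong refl (pre-t-≢ q q∈ q≢p) (post-t q q∈)) (+-identityʳ _)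

  fire-p-≤ : ∀ {u} w → u ∈ trans N → fire N u w p ≤ w p
  fire-p-≤ {u} w u∈ = begin
    (w p ∸ pre N u p) + post N u p  ≡⟨ cong (λ k → (w p ∸ pre N u p) + k) (•p-empty u u∈) ⟩
    (w p ∸ pre N u p) + 0           ≡⟨ +-identityʳ _ ⟩
    w p ∸ pre N u p                 ≤⟨ m∸n≤m (w p) (pre N u p) ⟩
    w p                             ∎
    where open ≤-Reasoning

  pre-p-≢t : ∀ {u} → u ∈ trans N → u ≢ t → pre N u p ≡ 0
  pre-p-≢t u∈ u≢t = ≮0⇒≡0 (λ 0<pre → u≢t (Equivalence.to (p•-t _ u∈) 0<pre))

  Reach⁺ : ∀ {x} → Reach N x → Reach N' x × x p ≤ m0 N p
  Reach⁺ (init x≗m0) =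
    init (λ q q∈ → x≗m0 q (proj₁ (∈-removePlace⁻ N q∈))) , ≤-reflexive (x≗m0 p p∈P)
  Reach⁺ (step {m} {m'} u u∈ r en m'≗fire) with Reach⁺ r
  ... | r' , m-p≤ = reach' , ≤-trans (subst (_≤ m p) (sym (m'≗fire p p∈P)) (fire-p-≤ m u∈)) m-p≤
    where
    reach' : Reach N' m'
    reach' with u ≟ t
    ... | yes refl = Reach-resp r' λ q q∈ → let q∈P , q≢p = ∈-removePlace⁻ N q∈ in
                       ≡-trans (sym (fire-t-≢ m q∈P q≢p)) (sym (m'≗fire q q∈P))
    ... | no u≢t = step u (∈-removeTransition⁺ N u∈ u≢t) r'
                     (λ q q∈ → en q (proj₁ (∈-removePlace⁻ N q∈)))
                     (λ q q∈ → m'≗fire q (proj₁ (∈-removePlace⁻ N q∈)))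

  -- Transitions of N' do not touch p, so its marking can be frozen at m0(p).
  Reach⁻ : ∀ {y} → Reach N' y → Reach N (update y p (m0 N p))
  Reach⁻ {y} (init y≗m0) = init (split-at p (λ _ → update-≡ y p _)
    λ q q≢p q∈ → ≡-trans (update-≢ y _ q≢p) (y≗m0 q (∈-removePlace⁺ N q∈ q≢p)))
  Reach⁻ {y} (step {m} u u∈' r en m'≗fire) =
    step u u∈ (Reach⁻ r) en-u (split-at p fire-at-p fire-off-p)
    where
    u∈ : u ∈ trans N
    u∈ = proj₁ (∈-removeTransition⁻ N u∈')
    pre-u-p : pre N u p ≡ 0
    pre-u-p = pre-p-≢t u∈ (proj₂ (∈-removeTransition⁻ N u∈'))
    m↑ : Marking
    m↑ = update m p (m0 N p)
    en-u : Enabled N u m↑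
    en-u = split-at p (λ _ → subst (_≤ m↑ p) (sym pre-u-p) z≤n)
      λ q q≢p q∈ → subst (pre N u q ≤_) (sym (update-≢ m _ q≢p)) (en q (∈-removePlace⁺ N q∈ q≢p))
    fire-at-p : p ∈ places N → update y p (m0 N p) p ≡ fire N u m↑ p
    fire-at-p _ = begin
      update y p (m0 N p) p            ≡⟨ update-≡ y p _ ⟩
      m0 N p                           ≡⟨ update-≡ m p _ ⟨
      m↑ p                             ≡⟨ +-identityʳ _ ⟨
      (m↑ p ∸ 0) + 0                   ≡⟨ ∸+-cong refl pre-u-p (•p-empty u u∈) ⟨
      fire N u m↑ p                    ∎
      where open ≡-Reasoning
    fire-off-p : ∀ q → q ≢ p → q ∈ places N → update y p (m0 N p) q ≡ fire N u m↑ q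
    fire-off-p q q≢p q∈ = begin
      update y p (m0 N p) q            ≡⟨ update-≢ y _ q≢p ⟩
      y q                              ≡⟨ m'≗fire q (∈-removePlace⁺ N q∈ q≢p) ⟩
      fire N u m q                     ≡⟨ cong (λ k → (k ∸ pre N u q) + post N u q) (update-≢ m _ q≢p) ⟨
      fire N u m↑ q                    ∎
      where open ≡-Reasoning

  Reach-drain : ∀ d {w w'} → Reach N w → w' p + d ≡ w p → (∀ q → q ∈ places N → q ≢ p → w' q ≡ w q) →
                Reach N w'
  Reach-drain zero    r w'p≡ w'≗w = Reach-resp r (split-at p (λ _ → sym (≡-trans (sym (+-identityʳ _)) w'p≡))
                                                   λ q q≢p q∈ → sym (w'≗w q q∈ q≢p))
  Reach-drain (suc d) {w} {w'} r w'p≡ w'≗w =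
    Reach-drain d (step t t∈T r en-t λ _ _ → refl) fired-p
      λ q q∈ q≢p → ≡-trans (w'≗w q q∈ q≢p) (sym (fire-t-≢ w q∈ q≢p))
    where
    en-t : Enabled N t w
    en-t = split-at p (λ _ → subst₂ _≤_ (sym pre-t-p) (≡-trans (sym (+-suc (w' p) d)) w'p≡) (s≤s z≤n))
      λ q q≢p q∈ → subst (_≤ w q) (sym (pre-t-≢ q q∈ q≢p)) z≤n
    fired-p : w' p + d ≡ fire N t w p
    fired-p = begin
      w' p + d                ≡⟨⟩
      suc (w' p + d) ∸ 1      ≡⟨ cong (_∸ 1) (+-suc (w' p) d) ⟨
      (w' p + suc d) ∸ 1      ≡⟨ cong (_∸ 1) w'p≡ ⟩
      w p ∸ 1                 ≡⟨ fire-t-p w ⟨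
      fire N t w p            ∎
      where open ≡-Reasoning

  Reach⁻-bounded : ∀ {x} → Reach N' x → x p ≤ m0 N p → Reach N x
  Reach⁻-bounded {x} r x-p≤ = Reach-drain (m0 N p ∸ x p) (Reach⁻ r)
    (≡-trans (m+[n∸m]≡n x-p≤) (sym (update-≡ x p _))) λ q _ q≢p → sym (update-≢ x _ q≢p)

NetAbstraction-removeSourceSink : ∀ {N1 Q N2 p t} → NetAbstraction N1 Q N2 → SourceSink N2 p t →
  NetAbstraction N1 (Q ⨾ leEq p (m0 N2 p)) (removeSourceSink N2 p t)
NetAbstraction-removeSourceSink {Q = Q} {N2} {p} abs (p∈P , t∈T , •p , p• , pre-t-p , pre-t-≢ , post-t) =
  NetAbstraction-transport
    (reproduces-identically λ {x} r s → let r' , x-p≤ = Reach⁺ r in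
      r' , Sat-⨾⁺ s (Equivalence.from (holds-leEq {p} {m0 N2 p} {x}) x-p≤))
    (reproduces-identically λ {x} r s → let sQ , hc = Sat-⨾⁻ Q s in
      Reach⁻-bounded r (Equivalence.to (holds-leEq {p} {m0 N2 p} {x}) hc) , sQ)
    abs
  where open SourceSinkRemoval p∈P t∈T •p p• pre-t-p pre-t-≢ post-t

unit : Name → Marking
unit r = update (λ _ → 0) r 1

move : Name → Name → Marking → Marking
move r s y n = (y n ∸ unit r n) + unit s n

Movable : Net → Name → Name → Set
Movable N r s = ∀ {y} → Reach N y → 1 ≤ y r → Reach N (move r s y)

Movable-refl : ∀ {N r} → Movable N r r
Movable-refl {r = r} {y} ry 1≤y-r = Reach-resp ry λ n _ → sym (split-at {X = λ n → move r r y n ≡ y n} r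
  (≡-trans (∸+-cong refl (update-≡ _ r 1) (update-≡ _ r 1)) (m∸n+n≡m 1≤y-r))
  (λ n n≢r → ≡-trans (∸+-cong refl (update-≢ _ 1 n≢r) (update-≢ _ 1 n≢r)) (+-identityʳ _)) n)

Movable-trans : ∀ {N r s u} → Movable N r s → Movable N s u → Movable N r u
Movable-trans {r = r} {s} {u} r→s s→u {y} ry 1≤y-r =
  Reach-resp (s→u (r→s ry 1≤y-r) 1≤s) λ n _ → cong (_+ unit u n) (m+n∸n≡m (y n ∸ unit r n) (unit s n))
  where
  1≤s : 1 ≤ move r s y s
  1≤s = subst (λ k → 1 ≤ (y s ∸ unit r s) + k) (sym (update-≡ _ s 1)) (m≤n+m 1 _)

≡-unit : ∀ {P : List Name} {f : Name → ℕ} {r} → f r ≡ 1 → (∀ n → n ∈ P → n ≢ r → f n ≡ 0) →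
  ∀ n → n ∈ P → f n ≡ unit r n
≡-unit {P} {f} {r} fr≡1 f≡0 = split-at {X = λ n → n ∈ P → f n ≡ unit r n} r
  (λ _ → ≡-trans fr≡1 (sym (update-≡ _ r 1)))
  λ n n≢r n∈ → ≡-trans (f≡0 n n∈ n≢r) (sym (update-≢ _ 1 n≢r))

Movable-edge : ∀ {N r s} t → t ∈ trans N →
  pre N t r ≡ 1 → (∀ n → n ∈ places N → n ≢ r → pre N t n ≡ 0) →
  post N t s ≡ 1 → (∀ n → n ∈ places N → n ≢ s → post N t n ≡ 0) → Movable N r s
Movable-edge {N} {r} {s} t t∈ pre-r pre-≢ post-s post-≢ {y} ry 1≤y-r = step t t∈ ry en
  λ n n∈ → ∸+-cong refl (sym (≡-unit pre-r pre-≢ n n∈)) (sym (≡-unit post-s post-≢ n n∈))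
  where
  en : Enabled N t y
  en = split-at {X = λ n → n ∈ places N → pre N t n ≤ y n} r (λ _ → subst (_≤ y r) (sym pre-r) 1≤y-r)
    λ n n≢r n∈ → subst (_≤ y n) (sym (pre-≢ n n∈ n≢r)) z≤n

Movable-many : ∀ {N r s} → Movable N r s → r ≢ s → ∀ d {y y'} → Reach N y →
  y' r + d ≡ y r → y' s ≡ y s + d → (∀ n → n ∈ places N → n ≢ r → n ≢ s → y' n ≡ y n) →
  Reach N y'
Movable-many {N} {r} {s} r→s r≢s zero {y} {y'} ry y'r y's y'n = Reach-resp ry
  (split-at₂ {X = λ n → n ∈ places N → y n ≡ y' n} r s
    (λ _ → ≡-trans (sym y'r) (+-identityʳ _)) (λ _ → ≡-trans (sym (+-identityʳ _)) (sym y's))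
    λ n n≢r n≢s n∈ → sym (y'n n n∈ n≢r n≢s))
Movable-many {r = r} {s} r→s r≢s (suc d) {y} {y'} ry y'r y's y'n =
  Movable-many r→s r≢s d (r→s ry 1≤y-r) moved-r moved-s
    λ n n∈ n≢r n≢s → ≡-trans (y'n n n∈ n≢r n≢s) (sym (moved-≢ n n≢r n≢s))
  where
  1≤y-r : 1 ≤ y r
  1≤y-r = subst (1 ≤_) y'r (subst (1 ≤_) (sym (+-suc (y' r) d)) (s≤s z≤n))
  moved-r : y' r + d ≡ move r s y r
  moved-r = begin
    y' r + d                     ≡⟨ cong (_∸ 1) (+-suc (y' r) d) ⟨
    (y' r + suc d) ∸ 1           ≡⟨ cong (_∸ 1) y'r ⟩
    y r ∸ 1                      ≡⟨ +-identityʳ _ ⟨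
    (y r ∸ 1) + 0                ≡⟨ ∸+-cong refl (update-≡ _ r 1) (update-≢ _ 1 r≢s) ⟨
    move r s y r                 ∎
    where open ≡-Reasoning
  moved-s : y' s ≡ move r s y s + d
  moved-s = begin
    y' s                         ≡⟨ y's ⟩
    y s + suc d                  ≡⟨ +-suc (y s) d ⟩
    suc (y s + d)                ≡⟨ cong (_+ d) (+-comm 1 (y s)) ⟩
    (y s + 1) + d                ≡⟨ cong (_+ d) (∸+-cong refl (update-≢ _ 1 (r≢s ∘ sym)) (update-≡ _ s 1)) ⟨
    move r s y s + d             ∎
    where open ≡-Reasoning
  moved-≢ : ∀ n → n ≢ r → n ≢ s → move r s y n ≡ y n
  moved-≢ n n≢r n≢s = ≡-trans (∸+-cong refl (update-≢ _ 1 n≢r) (update-≢ _ 1 n≢s)) (+-identityʳ _)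

private
  rebalance : ∀ {a A b B d} → a + A ≡ b + B → b ≡ a + d → A ≡ B + d
  rebalance {a} {A} {b} {B} {d} a+A≡b+B b≡a+d =
    +-cancelˡ-≡ a A (B + d) (≡-trans a+A≡b+B (≡-trans (cong (_+ B) b≡a+d) (xy∙z≈x∙zy a d B)))

  off-tail : ∀ {P r T} {u v : Marking} → (∀ n → n ∈ P → n ∉ r ∷ T → u n ≡ v n) → u r ≡ v r →
             ∀ n → n ∈ P → n ∉ T → u n ≡ v n
  off-tail {P} {r} {T} {u} {v} off u-r = split-at {X = λ n → n ∈ P → n ∉ T → u n ≡ v n} r (λ _ _ → u-r)
    λ n n≢r n∈ n∉T → off n n∈ λ { (here n≡r) → n≢r n≡r ; (there n∈T) → n∉T n∈T }

-- The first place of S is settled by a bulk move to the second one before, or from it after,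
-- redistributing over the rest.
redistribute : ∀ {N} S → Unique S → (∀ {r s} → r ∈ S → s ∈ S → Movable N r s) →
  ∀ {y w} → Reach N y → (∀ n → n ∈ places N → n ∉ S → w n ≡ y n) → sumOver S w ≡ sumOver S y →
  Reach N w
redistribute [] _ _ ry off _ = Reach-resp ry λ n n∈ → sym (off n n∈ λ ())
redistribute {N} (r ∷ []) _ _ {y} {w} ry off Σw≡Σy = Reach-resp ry
  (split-at {X = λ n → n ∈ places N → y n ≡ w n} r (λ _ → +-cancelʳ-≡ 0 (y r) (w r) (sym Σw≡Σy))
    λ n n≢r n∈ → sym (off n n∈ λ { (here n≡r) → n≢r n≡r }))
redistribute {N} (r ∷ s ∷ S) (r∉T ∷ T!) movable {y} {w} ry off Σw≡Σy with w r ≤? y r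
... | yes w-r≤y-r = redistribute (s ∷ S) T! (λ a∈ b∈ → movable (there a∈) (there b∈)) rz
  (off-tail (λ n n∈ n∉ → ≡-trans (off n n∈ n∉)
                                 (sym (settle-≢ y (w r) d (n∉ ∘ here) (n∉ ∘ there ∘ here))))
            (sym (settle-r y (w r) d r≢s)))
  (≡-trans (rebalance Σw≡Σy (sym (m+[n∸m]≡n w-r≤y-r)))
           (sym (sumOver-settle (s ∷ S) y (w r) d T! (All.All¬⇒¬Any r∉T) (here refl))))
  where
  r≢s : r ≢ s
  r≢s = All.head r∉T
  d : ℕ
  d = y r ∸ w r
  rz : Reach N (settle y r (w r) s d)
  rz = Movable-many (movable (here refl) (there (here refl))) r≢s d ry
    (≡-trans (cong (_+ d) (settle-r y (w r) d r≢s)) (m+[n∸m]≡n w-r≤y-r)) (settle-s y r (w r) s d)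
    λ n _ → settle-≢ y (w r) d
... | no w-r≰y-r = Movable-many (movable (there (here refl)) (here refl)) (r≢s ∘ sym) d rz
  (sym (settle-s w r (y r) s d)) (≡-trans (sym (m+[n∸m]≡n y-r≤w-r)) (cong (_+ d) (sym (settle-r w (y r) d r≢s))))
  λ n _ n≢s n≢r → sym (settle-≢ w (y r) d n≢r n≢s)
  where
  r≢s : r ≢ s
  r≢s = All.head r∉T
  y-r≤w-r : y r ≤ w r
  y-r≤w-r = <⇒≤ (≰⇒> w-r≰y-r)
  d : ℕ
  d = w r ∸ y r
  rz : Reach N (settle w r (y r) s d)
  rz = redistribute (s ∷ S) T! (λ a∈ b∈ → movable (there a∈) (there b∈)) ry
    (off-tail (λ n n∈ n∉ → ≡-trans (settle-≢ w (y r) d (n∉ ∘ here) (n∉ ∘ there ∘ here))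
                                   (off n n∈ n∉))
              (settle-r w (y r) d r≢s))
    (≡-trans (sumOver-settle (s ∷ S) w (y r) d T! (All.All¬⇒¬Any r∉T) (here refl))
             (sym (rebalance (sym Σw≡Σy) (sym (m+[n∸m]≡n y-r≤w-r)))))

dominating-redistribution : ∀ S → Unique S → ∀ (f g : Marking) → sumOver S f ≤ sumOver S g →
  ∃[ h ] ((∀ n → n ∉ S → h n ≡ g n) × sumOver S h ≡ sumOver S g × (∀ n → n ∈ S → f n ≤ h n))
dominating-redistribution []      _  f g _      = g , (λ _ _ → refl) , refl , λ _ ()
dominating-redistribution (r ∷ S) S! f g Σf≤Σg = h , h-off , Σh , f≤h
  where
  d : ℕ
  d = sumOver (r ∷ S) g ∸ sumOver (r ∷ S) f
  k : Marking
  k n = if ⌊ n ∈? r ∷ S ⌋ then f n else g n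
  k-in : ∀ {n} → n ∈ r ∷ S → k n ≡ f n
  k-in {n} n∈ with n ∈? r ∷ S
  ... | yes _  = refl
  ... | no n∉ = ⊥-elim (n∉ n∈)
  k-out : ∀ {n} → n ∉ r ∷ S → k n ≡ g n
  k-out {n} n∉ with n ∈? r ∷ S
  ... | yes n∈ = ⊥-elim (n∉ n∈)
  ... | no _   = refl
  h : Marking
  h = update k r (f r + d)
  h-off : ∀ n → n ∉ r ∷ S → h n ≡ g n
  h-off n n∉ = ≡-trans (update-≢ k _ λ n≡r → n∉ (here n≡r)) (k-out n∉)
  Σh : sumOver (r ∷ S) h ≡ sumOver (r ∷ S) g
  Σh = +-cancelʳ-≡ (f r) _ _ (begin
    sumOver (r ∷ S) h + f r              ≡⟨ cong (_+_ (sumOver (r ∷ S) h)) (k-in (here refl)) ⟨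
    sumOver (r ∷ S) h + k r              ≡⟨ sumOver-change (r ∷ S) S! (here refl) (λ _ _ → update-≢ k _) ⟩
    sumOver (r ∷ S) k + h r              ≡⟨ cong₂ _+_ (sumOver-cong (r ∷ S) λ _ → k-in) (update-≡ k r _) ⟩
    sumOver (r ∷ S) f + (f r + d)        ≡⟨ x∙yz≈xz∙y (sumOver (r ∷ S) f) (f r) d ⟩
    (sumOver (r ∷ S) f + d) + f r        ≡⟨ cong (_+ f r) (m+[n∸m]≡n Σf≤Σg) ⟩
    sumOver (r ∷ S) g + f r              ∎)
    where open ≡-Reasoning
  f≤h : ∀ n → n ∈ r ∷ S → f n ≤ h n
  f≤h = split-at {X = λ n → n ∈ r ∷ S → f n ≤ h n} r
    (λ _ → subst (f r ≤_) (sym (update-≡ k r _)) (m≤m+n (f r) d))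
    λ n n≢r n∈ → subst (f n ≤_) (sym (≡-trans (update-≢ k _ n≢r) (k-in n∈))) ≤-refl

module _ {R : Name → Name → Set} (R-refl : ∀ {r} → R r r) (R-trans : ∀ {r s u} → R r s → R s u → R r u) where

  private
    module _ (x : Name) where
      -- drop 1 (cycPairs (x ∷ y ∷ t)) is the path y → … → x through the elements of t.
      path-to-x : ∀ y t → All (uncurry R) (drop 1 (cycPairs (x ∷ y ∷ t))) → ∀ {w} → w ∈ y ∷ t → R w x
      path-to-x y []      (y→x ∷ []) (here refl)  = y→x
      path-to-x y (z ∷ t) (y→z ∷ zt) (here refl)  = R-trans y→z (path-to-x z t zt (here refl))
      path-to-x y (z ∷ t) (_ ∷ zt)   (there w∈)   = path-to-x z t zt w∈

      path-from-y : ∀ y t → All (uncurry R) (drop 1 (cycPairs (x ∷ y ∷ t))) → ∀ {w} → w ∈ y ∷ t → R y w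
      path-from-y y t       _          (here refl) = R-refl
      path-from-y y (z ∷ t) (y→z ∷ zt) (there w∈)  = R-trans y→z (path-from-y z t zt w∈)

  cycle-connected : ∀ A → All (uncurry R) (cycPairs A) → ∀ {r s} → r ∈ A → s ∈ A → R r s
  cycle-connected (x ∷ [])    _             (here refl) (here refl) = R-refl
  cycle-connected (x ∷ y ∷ t) (x→y ∷ cycle) r∈ s∈ = R-trans (to-x r∈) (from-x s∈)
    where
    to-x : ∀ {r} → r ∈ x ∷ y ∷ t → R r x
    to-x (here refl) = R-refl
    to-x (there r∈)  = path-to-x x y t cycle r∈
    from-x : ∀ {s} → s ∈ x ∷ y ∷ t → R x s
    from-x (here refl) = R-refl
    from-x (there s∈)  = R-trans x→y (path-from-y x y t cycle s∈)

-- Agglomeration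

module Agglomeration {N : Net} {A : List Name} {a : Name}
  (A! : Unique A) (A⊆P : All (_∈ places N) A) (a∉P : a ∉ places N) where

  N' : Net
  N' = agglomerate N A a

  -- pre N' u, post N' u and m0 N' are the collapses of the corresponding functions of N.
  collapse : Marking → Marking
  collapse y = update y a (sumOver A y)

  collapse-a : ∀ y → collapse y a ≡ sumOver A y
  collapse-a y = update-≡ y a _

  collapse-off : ∀ y {r} → r ≢ a → collapse y r ≡ y r
  collapse-off y = update-≢ y _

  collapse-≢ : ∀ y {r} → r ∈ places N → collapse y r ≡ y r
  collapse-≢ y r∈ = collapse-off y (∈∧∉⇒≢ r∈ a∉P)

  collapse-sumEq : ∀ y → collapse y a ≡ sumOver A (collapse y)
  collapse-sumEq y = ≡-trans (collapse-a y) (sumOver-cong A λ q q∈ → sym (collapse-≢ y (All.lookup A⊆P q∈)))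

  places⁺ : ∀ {r} → r ∈ places N → r ∉ A → r ∈ places N'
  places⁺ r∈ r∉A = there (∈-filter⁺ (λ r → ¬? (r ∈? A)) r∈ r∉A)

  places-elim : ∀ {X : Name → Set} → X a → (∀ r → r ∈ places N → r ∉ A → X r) →
                ∀ r → r ∈ places N' → X r
  places-elim Xa _  r (here refl) = Xa
  places-elim _  Xr r (there r∈)  =
    let r∈P , r∉A = ∈-filter⁻ (λ r → ¬? (r ∈? A)) {xs = places N} r∈ in Xr r r∈P r∉A

  OffA : Marking → Marking → Set
  OffA x y = ∀ r → r ∈ places N → r ∉ A → x r ≡ y r

  collapse-resp : ∀ {x y} → OffA x y → sumOver A x ≡ sumOver A y → collapse x ≗[ places N' ] collapse y
  collapse-resp {x} {y} off Σ≡ = places-elim (≡-trans (collapse-a x) (≡-trans Σ≡ (sym (collapse-a y))))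
    λ r r∈ r∉A → ≡-trans (collapse-≢ x r∈) (≡-trans (off r r∈ r∉A) (sym (collapse-≢ y r∈)))

  collapse-resp-≗ : ∀ {x y} → x ≗[ places N ] y → collapse x ≗[ places N' ] collapse y
  collapse-resp-≗ x≗y =
    collapse-resp (λ r r∈ _ → x≗y r r∈) (sumOver-cong A λ q q∈ → x≗y q (All.lookup A⊆P q∈))

  collapse-≗⁻ : ∀ {y z} → collapse y ≗[ places N' ] z → OffA y z × sumOver A y ≡ z a
  collapse-≗⁻ {y} y≗z = (λ r r∈ r∉A → ≡-trans (sym (collapse-≢ y r∈)) (y≗z r (places⁺ r∈ r∉A))) ,
                        ≡-trans (sym (collapse-a y)) (y≗z a (here refl))

  Enabled-collapse : ∀ {u m} → Enabled N u m → Enabled N' u (collapse m)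
  Enabled-collapse {u} {m} en = places-elim {X = λ r → pre N' u r ≤ collapse m r}
    (subst₂ _≤_ (sym (collapse-a (pre N u))) (sym (collapse-a m))
                (sumOver-mono A λ q q∈ → en q (All.lookup A⊆P q∈)))
    λ r r∈ _ → subst₂ _≤_ (sym (collapse-≢ (pre N u) r∈)) (sym (collapse-≢ m r∈)) (en r r∈)

  fire-collapse : ∀ {u m} → Enabled N u m → collapse (fire N u m) ≗[ places N' ] fire N' u (collapse m)
  fire-collapse {u} {m} en = places-elim
    (≡-trans (collapse-a (fire N u m)) (≡-trans (sumOver-fire A {N} {u} λ q q∈ → en q (All.lookup A⊆P q∈))
      (sym (∸+-cong (collapse-a m) (collapse-a (pre N u)) (collapse-a (post N u))))))
    λ r r∈ _ → ≡-trans (collapse-≢ (fire N u m) r∈)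
      (sym (∸+-cong (collapse-≢ m r∈) (collapse-≢ (pre N u) r∈) (collapse-≢ (post N u) r∈)))

  Reach-collapse : ∀ {x} → Reach N x → Reach N' (collapse x)
  Reach-collapse (init x≗m0) = init (collapse-resp-≗ x≗m0)
  Reach-collapse (step u u∈ r en m'≗fire) = step u u∈ (Reach-collapse r) (Enabled-collapse en)
    λ q q∈ → ≡-trans (collapse-resp-≗ m'≗fire q q∈) (fire-collapse en q q∈)

  module Lift (Good : Marking → Set) (Good-m0 : Good (m0 N))
    (lift-fire : ∀ {y u} → Reach N y → Good y → u ∈ trans N → Enabled N' u (collapse y) →
                 ∃[ y' ] (Reach N y' × Good y' × collapse y' ≗[ places N' ] fire N' u (collapse y))) where

    lift : ∀ {z} → Reach N' z → ∃[ y ] (Reach N y × Good y × collapse y ≗[ places N' ] z)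
    lift (init z≗m0) = m0 N , init (λ _ _ → refl) , Good-m0 , ≗-sym z≗m0
    lift (step u u∈ r en z'≗fire) =
      let y , ry , good , y≗z = lift r
          y' , ry' , good' , y'≗fire = lift-fire ry good u∈ (Enabled-resp {N'} en (≗-sym y≗z))
      in y' , ry' , good' , λ q q∈ → ≡-trans (y'≗fire q q∈)
                                    (≡-trans (fire-resp {N'} u y≗z q q∈) (sym (z'≗fire q q∈)))

  fire-staged : ∀ {u w y} → Reach N w → u ∈ trans N → Enabled N u w → collapse w ≗[ places N' ] collapse y →
    Reach N (fire N u w) × collapse (fire N u w) ≗[ places N' ] fire N' u (collapse y)
  fire-staged {u} rw u∈ en w≗y =
    step u u∈ rw en (λ _ _ → refl) , λ r r∈ → ≡-trans (fire-collapse en r r∈) (fire-resp {N'} u w≗y r r∈)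

  module Connected (movable : ∀ {r s} → r ∈ A → s ∈ A → Movable N r s) where

    stage : ∀ {y u} → Reach N y → Enabled N' u (collapse y) →
      ∃[ w ] (Reach N w × Enabled N u w × collapse w ≗[ places N' ] collapse y)
    stage {y} {u} ry en' with dominating-redistribution A A! (pre N u) y
                                (subst₂ _≤_ (collapse-a (pre N u)) (collapse-a y) (en' a (here refl)))
    ... | w , w-off , Σw , pre≤w =
      w , redistribute A A! movable ry (λ n _ n∉ → w-off n n∉) Σw , en ,
      collapse-resp (λ n _ n∉ → w-off n n∉) Σw
      where
      en : Enabled N u w
      en r r∈ with r ∈? A
      ... | yes r∈A = pre≤w r r∈A
      ... | no r∉A  = subst₂ _≤_ (collapse-≢ (pre N u) r∈) (≡-trans (collapse-≢ y r∈) (sym (w-off r r∉A)))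
                                 (en' r (places⁺ r∈ r∉A))

    lift-fire : ∀ {y u} → Reach N y → ⊤ → u ∈ trans N → Enabled N' u (collapse y) →
                ∃[ y' ] (Reach N y' × ⊤ × collapse y' ≗[ places N' ] fire N' u (collapse y))
    lift-fire {u = u} ry _ u∈ en' =
      let w , rw , en , w≗y = stage ry en'
          rw' , fired = fire-staged rw u∈ en w≗y
      in fire N u w , rw' , tt , fired

    Reach⁻ : ∀ {z} → Reach N' z → z a ≡ sumOver A z → Reach N z
    Reach⁻ rz z-a with Lift.lift (λ _ → ⊤) tt lift-fire rz
    ... | y , ry , _ , y≗z = let off , Σy = collapse-≗⁻ y≗z in
      redistribute A A! movable ry (λ n n∈ n∉ → sym (off n n∈ n∉)) (≡-trans (sym z-a) (sym Σy))

  -- All tokens of A are kept on p until they are needed on q.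
  module Chain {p q t : Name} (p≢q : p ≢ q) (A≡pq : ∀ r → (r ∈ A) ⇔ (r ≡ p ⊎ r ≡ q))
    (t∈T : t ∈ trans N)
    (•t : ∀ r → r ∈ places N → (0 < pre N t r) ⇔ (r ≡ p))
    (t• : ∀ r → r ∈ places N → (0 < post N t r) ⇔ (r ≡ q))
    (pre-t-p : pre N t p ≡ 1) (post-t-q : post N t q ≡ 1)
    (•q : ∀ u → u ∈ trans N → (0 < post N u q) ⇔ (u ≡ t))
    (m0-q : m0 N q ≡ 0) where

    ΣA : ∀ f → sumOver A f ≡ f p + f q
    ΣA = sumOver-pair A A! p≢q A≡pq

    p∈P : p ∈ places N
    p∈P = All.lookup A⊆P (Equivalence.from (A≡pq p) (inj₁ refl))

    q∈P : q ∈ places N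
    q∈P = All.lookup A⊆P (Equivalence.from (A≡pq q) (inj₂ refl))

    ∉A : ∀ {r} → r ≢ p → r ≢ q → r ∉ A
    ∉A r≢p r≢q r∈A with Equivalence.to (A≡pq _) r∈A
    ... | inj₁ r≡p = r≢p r≡p
    ... | inj₂ r≡q = r≢q r≡q

    ∉A⇒≢p : ∀ {r} → r ∉ A → r ≢ p
    ∉A⇒≢p r∉A r≡p = r∉A (Equivalence.from (A≡pq _) (inj₁ r≡p))

    ∉A⇒≢q : ∀ {r} → r ∉ A → r ≢ q
    ∉A⇒≢q r∉A r≡q = r∉A (Equivalence.from (A≡pq _) (inj₂ r≡q))

    pre-t-≢ : ∀ r → r ∈ places N → r ≢ p → pre N t r ≡ 0
    pre-t-≢ r r∈ r≢p = ≮0⇒≡0 λ 0<pre → r≢p (Equivalence.to (•t r r∈) 0<pre)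

    post-t-≢ : ∀ r → r ∈ places N → r ≢ q → post N t r ≡ 0
    post-t-≢ r r∈ r≢q = ≮0⇒≡0 λ 0<post → r≢q (Equivalence.to (t• r r∈) 0<post)

    t-moves : Movable N p q
    t-moves = Movable-edge t t∈T pre-t-p pre-t-≢ post-t-q post-t-≢

    t-idle : ∀ {z} → Enabled N' t z → fire N' t z ≗[ places N' ] z
    t-idle {z} en = places-elim
      (≡-trans (∸+-cong refl pre'-a post'-a) (m∸n+n≡m (subst (_≤ z a) pre'-a (en a (here refl)))))
      λ r r∈ r∉A → ≡-trans (∸+-cong refl (≡-trans (collapse-≢ (pre N t) r∈) (pre-t-≢ r r∈ (∉A⇒≢p r∉A)))
                                          (≡-trans (collapse-≢ (post N t) r∈) (post-t-≢ r r∈ (∉A⇒≢q r∉A))))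
                           (+-identityʳ _)
      where
      pre'-a : pre N' t a ≡ 1
      pre'-a = ≡-trans (collapse-a (pre N t))
                       (≡-trans (ΣA (pre N t)) (cong₂ _+_ pre-t-p (pre-t-≢ q q∈P (p≢q ∘ sym))))
      post'-a : post N' t a ≡ 1
      post'-a = ≡-trans (collapse-a (post N t))
                        (≡-trans (ΣA (post N t)) (cong₂ _+_ (post-t-≢ p p∈P p≢q) post-t-q))

    stage : ∀ {y u} → Reach N y → y q ≡ 0 → Enabled N' u (collapse y) →
      ∃[ w ] (Reach N w × Enabled N u w × w q ≡ pre N u q × collapse w ≗[ places N' ] collapse y)
    stage {y} {u} ry y-q en' = w , rw , en , w-q , w≗y
      where
      k : ℕ
      k = pre N u q
      w : Marking
      w = settle y p (y p ∸ k) q k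
      pre-pq≤y-p : pre N u p + k ≤ y p
      pre-pq≤y-p = subst₂ _≤_ (≡-trans (collapse-a (pre N u)) (ΣA (pre N u)))
                              (≡-trans (collapse-a y)
                                (≡-trans (ΣA y) (≡-trans (cong (_+_ (y p)) y-q) (+-identityʳ _))))
                              (en' a (here refl))
      k≤y-p : k ≤ y p
      k≤y-p = m+n≤o⇒n≤o (pre N u p) pre-pq≤y-p
      w-p : w p ≡ y p ∸ k
      w-p = settle-r y (y p ∸ k) k p≢q
      w-q : w q ≡ k
      w-q = ≡-trans (settle-s y p (y p ∸ k) q k) (cong (_+ k) y-q)
      rw : Reach N w
      rw = Movable-many t-moves p≢q k ry (≡-trans (cong (_+ k) w-p) (m∸n+n≡m k≤y-p)) (settle-s y p (y p ∸ k) q k)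
        λ r _ → settle-≢ y (y p ∸ k) k
      en : Enabled N u w
      en = split-at₂ {X = λ r → r ∈ places N → pre N u r ≤ w r} p q
        (λ _ → subst (pre N u p ≤_) (sym w-p) (m+n≤o⇒m≤o∸n (pre N u p) pre-pq≤y-p))
        (λ _ → subst (k ≤_) (sym w-q) ≤-refl)
        λ r r≢p r≢q r∈ → subst₂ _≤_ (collapse-≢ (pre N u) r∈)
                                    (≡-trans (collapse-≢ y r∈) (sym (settle-≢ y (y p ∸ k) k r≢p r≢q)))
                                    (en' r (places⁺ r∈ (∉A r≢p r≢q)))
      w≗y : collapse w ≗[ places N' ] collapse y
      w≗y = collapse-resp (λ r _ r∉A → settle-≢ y (y p ∸ k) k (∉A⇒≢p r∉A) (∉A⇒≢q r∉A)) (begin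
        sumOver A w              ≡⟨ ΣA w ⟩
        w p + w q                ≡⟨ cong₂ _+_ w-p (settle-s y p (y p ∸ k) q k) ⟩
        (y p ∸ k) + (y q + k)    ≡⟨ x∙yz≈xz∙y (y p ∸ k) (y q) k ⟩
        ((y p ∸ k) + k) + y q    ≡⟨ cong (_+ y q) (m∸n+n≡m k≤y-p) ⟩
        y p + y q                ≡⟨ ΣA y ⟨
        sumOver A y              ∎)
        where open ≡-Reasoning

    emptied-q : ∀ {u w} → u ∈ trans N → u ≢ t → w q ≡ pre N u q → fire N u w q ≡ 0
    emptied-q {u} {w} u∈ u≢t w-q = ≡-trans
      (∸+-cong w-q (refl {x = pre N u q}) (≮0⇒≡0 λ 0<post → u≢t (Equivalence.to (•q u u∈) 0<post)))
      (≡-trans (+-identityʳ _) (n∸n≡0 (pre N u q)))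

    lift-fire : ∀ {y u} → Reach N y → y q ≡ 0 → u ∈ trans N → Enabled N' u (collapse y) →
                ∃[ y' ] (Reach N y' × y' q ≡ 0 × collapse y' ≗[ places N' ] fire N' u (collapse y))
    lift-fire {y} {u} ry y-q u∈ en' with u ≟ t
    ... | yes refl = y , ry , y-q , ≗-sym (t-idle en')
    ... | no u≢t   =
      let w , rw , en , w-q , w≗y = stage ry y-q en'
          rw' , fired = fire-staged rw u∈ en w≗y
      in fire N u w , rw' , emptied-q {w = w} u∈ u≢t w-q , fired

    Reach⁻ : ∀ {z} → Reach N' z → z a ≡ sumOver A z → Reach N z
    Reach⁻ {z} rz z-a with Lift.lift (λ y → y q ≡ 0) m0-q lift-fire rz
    ... | y , ry , y-q , y≗z = let off , Σy = collapse-≗⁻ y≗z in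
      Movable-many t-moves p≢q (z q) ry
        (begin
          z p + z q     ≡⟨ ΣA z ⟨
          sumOver A z   ≡⟨ z-a ⟨
          z a           ≡⟨ Σy ⟨
          sumOver A y   ≡⟨ ΣA y ⟩
          y p + y q     ≡⟨ cong (_+_ (y p)) y-q ⟩
          y p + 0       ≡⟨ +-identityʳ _ ⟩
          y p           ∎)
        (cong (_+ z q) (sym y-q))
        λ r r∈ r≢p r≢q → sym (off r r∈ (∉A r≢p r≢q))
      where open ≡-Reasoning

  Reach-agglomerate⁻ : ChainAgglomerable N A ⊎ LoopAgglomerable N A →
                       ∀ {z} → Reach N' z → z a ≡ sumOver A z → Reach N z
  Reach-agglomerate⁻ (inj₂ (_ , _ , cycle)) = Connected.Reach⁻
    (cycle-connected {R = Movable N} Movable-refl Movable-trans A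
      (All.map (λ (t , t∈ , pre-i , pre-≢ , post-j , post-≢) {y} →
                  Movable-edge t t∈ pre-i pre-≢ post-j post-≢ {y}) cycle))
  Reach-agglomerate⁻ (inj₁ (_ , _ , p , q , A≡pq , t , t∈ , •t , t• , pre-t-p , post-t-q , •q , m0-q))
    with p ≟ q
  ... | no p≢q = Chain.Reach⁻ p≢q A≡pq t∈ •t t• pre-t-p post-t-q •q m0-q
  ... | yes refl =
    Connected.Reach⁻ λ r∈ s∈ → subst₂ (Movable N) (sym (only-p r∈)) (sym (only-p s∈)) Movable-refl
    where
    only-p : ∀ {r} → r ∈ A → r ≡ p
    only-p r∈ with Equivalence.to (A≡pq _) r∈
    ... | inj₁ r≡p = r≡p
    ... | inj₂ r≡p = r≡p

NetAbstraction-agglomerate : ∀ {N1 Q N2 A a} → NetAbstraction N1 Q N2 →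
  ChainAgglomerable N2 A ⊎ LoopAgglomerable N2 A → a ∉ vars Q → a ∉ places N2 → a ∉ places N1 →
  NetAbstraction N1 (Q ⨾ sumEq a A) (agglomerate N2 A a)
NetAbstraction-agglomerate {N1} {Q} {N2} {A} {a} abs agg a∉Q a∉P2 a∉P1 = NetAbstraction-transport
  (λ x rx sx → collapse x , Reach-collapse rx ,
    Sat-⨾⁺ (Sat-resp Q (λ q q∈ → sym (collapse-off x (∈∧∉⇒≢ q∈ a∉Q))) sx)
           (Equivalence.from (holds-sumEq {a} {A} {collapse x}) (collapse-sumEq x)) ,
    λ p p∈ → sym (collapse-off x (∈∧∉⇒≢ p∈ a∉P1)))
  (reproduces-identically λ {z} rz sz → let sQ , hc = Sat-⨾⁻ Q sz in
    Reach-agglomerate⁻ agg rz (Equivalence.to (holds-sumEq {a} {A} {z}) hc) , sQ)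
  abs
  where
  unique : ChainAgglomerable N2 A ⊎ LoopAgglomerable N2 A → Unique A
  unique (inj₁ (A! , _)) = A!
  unique (inj₂ (A! , _)) = A!
  ⊆places : ChainAgglomerable N2 A ⊎ LoopAgglomerable N2 A → All (_∈ places N2) A
  ⊆places (inj₁ (_ , A⊆P , _)) = A⊆P
  ⊆places (inj₂ (_ , A⊆P , _)) = A⊆P
  open Agglomeration (unique agg) (⊆places agg) a∉P2

theorem5 :
  (∀ (N : Net) → NetAbstraction N [] N)
  × (∀ (N1 : Net) (Q : System) (N2 : Net) → NetAbstraction N1 Q N2 →
      -- (T)
      (∀ (t : Name) → RedundantTransition N2 t →
         NetAbstraction N1 Q (removeTransition N2 t))
      -- (R)
      × (∀ (p : Name) (I : List Name) (v : Name → ℕ) (b : ℕ) →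
           RedundantPlace N2 p I v b →
           NetAbstraction N1 (Q ⨾ markingEq p I v b) (removePlace N2 p))
      -- (A)
      × (∀ (A : List Name) (a : Name) →
           (ChainAgglomerable N2 A ⊎ LoopAgglomerable N2 A) →
           a ∉ vars Q → a ∉ places N2 → a ∉ places N1 →
           NetAbstraction N1 (Q ⨾ sumEq a A) (agglomerate N2 A a))
      -- (L)
      × (∀ (p t : Name) → SourceSink N2 p t →
           NetAbstraction N1 (Q ⨾ leEq p (m0 N2 p)) (removeSourceSink N2 p t)))
theorem5 = NetAbstraction-refl , λ N1 Q N2 abs →
  (λ t → NetAbstraction-removeTransition abs) ,
  (λ p I v b → NetAbstraction-removePlace abs) ,
  (λ A a agg → NetAbstraction-agglomerate abs agg) ,
  (λ p t → NetAbstraction-removeSourceSink abs)
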